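{- Let $G$ be an undirected graph with rooted spanning tree $T$, and let $f$ be a positive integer. Let $G'$ be obtained from $G$ by subdividing every non-tree edge $e=(u,v)\in E_G\setminus E_T$ by a new vertex $w_e$ into two edges, the edge $(u,w_e)$ (also named $e$) and the edge $(w_e,v)$ (named $e'$); let $T'$ be the spanning tree of $G'$ obtained from $T$ by adding all edges $(u,w_e)$ (named $e$), rooted at the root of $T$; and let $\sigma:E_G\to E_{T'}$ map each tree edge to itself and each non-tree edge $e$ to the edge of $T'$ named $e$. Suppose $(\mathrm{TL}_{G',f},\mathrm{TD}_f)$ is a tree edge $f$-FTC labeling scheme for $G'$ and $T'$. Define $\mathrm{L}_{G,f}(x)=\mathrm{TL}_{G',f}(x)$ if $x\in V_G\cup E_T$ and $\mathrm{L}_{G,f}(x)=\mathrm{TL}_{G',f}(\sigma(x))$ otherwise. Then $(\mathrm{L}_{G,f},\mathrm{TD}_f)$ is an $f$-FTC labeling scheme for $G$.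
   Context: A tree edge $f$-FTC labeling scheme for a graph $H$ and rooted spanning tree $T_H$ assigns binary labels to the vertices of $H$ and the edges of $T_H$, together with a universal decoder such that for every query $(s,t,F)$ with $s,t\in V_H$, $F\subseteq E_{T_H}$, $|F|\le f$, the decoder, given only the labels of $s$, $t$ and the edges in $F$, outputs $1$ iff $s$ and $t$ are connected in $H-F$. An $f$-FTC labeling scheme for $G$ is the same with labels on all vertices and edges of $G$ and queries with arbitrary $F\subseteq E_G$, $|F|\le f$. -}

module Defs where

open import Data.Nat using (ℕ; _≤_)
open import Data.Bool using (Bool; true; false)
open import Data.List using (List; map; length)
open import Data.List.Membership.Propositional using (_∉_)
open import Data.List.Relation.Unary.All using (All)
open import Data.List.Relation.Unary.Unique.Propositional using (Unique)
open import Data.Product using (Σ; ∃; _×_; _,_; proj₁; proj₂)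
open import Data.Sum using (_⊎_; inj₁; inj₂)
open import Relation.Binary.PropositionalEquality using (_≡_; _≢_)
open import Relation.Binary.Construct.Closure.ReflexiveTransitive using (Star)
open import Relation.Nullary using (¬_)
open import Function.Bundles using (_⇔_)

-- A (multi)graph given by a vertex type V, an edge type E and an
-- endpoint map ends : E → V × V (undirected: orientation irrelevant).

Label : Set
Label = List Bool

Step : {V E : Set} → (E → V × V) → (E → Set) → V → V → Set
Step {V} {E} ends P s t =
  ∃ λ (e : E) → P e × (ends e ≡ (s , t) ⊎ ends e ≡ (t , s))

ConnVia : {V E : Set} → (E → V × V) → (E → Set) → V → V → Set
ConnVia ends P = Star (Step ends P)

ConnMinus : {V E : Set} → (E → V × V) → List E → V → V → Set
ConnMinus ends F = ConnVia ends (λ e → e ∉ F)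

InTree : {E : Set} → (E → Bool) → E → Set
InTree inT e = inT e ≡ true

-- T (the edges flagged by inT) is a spanning tree of H:
-- it is connected and spanning, and minimally so (every tree edge is a bridge of T).
IsSpanningTree : {V E : Set} → (E → V × V) → (E → Bool) → Set
IsSpanningTree {V} {E} ends inT =
  ((s t : V) → ConnVia ends (InTree inT) s t)
  × ((e : E) → InTree inT e →
       ¬ ConnVia ends (λ e' → InTree inT e' × e' ≢ e) (proj₁ (ends e)) (proj₂ (ends e)))

-- Universal decoder: labels of s, of t, and the list of labels of the edges of F.
Decoder : Set
Decoder = Label → Label → List Label → Bool

-- Tree edge f-FTC labeling scheme for H with rooted spanning tree (inT, root).
-- F is a set of at most f tree edges, given as a duplicate-free list.
IsTreeFTCScheme : (f : ℕ) {V E : Set} (ends : E → V × V) (inT : E → Bool) (root : V)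
  → (V → Label) → (E → Label) → Decoder → Set
IsTreeFTCScheme f {V} {E} ends inT root Lv Le D =
  (s t : V) (F : List E) → Unique F → length F ≤ f → All (InTree inT) F →
  (D (Lv s) (Lv t) (map Le F) ≡ true) ⇔ ConnMinus ends F s t

IsFTCScheme : (f : ℕ) {V E : Set} (ends : E → V × V)
  → (V → Label) → (E → Label) → Decoder → Set
IsFTCScheme f {V} {E} ends Lv Le D =
  (s t : V) (F : List E) → Unique F → length F ≤ f →
  (D (Lv s) (Lv t) (map Le F) ≡ true) ⇔ ConnMinus ends F s t

module Subdivide {V E : Set} (ends : E → V × V) (inT : E → Bool) where

  NonTree : Set
  NonTree = Σ E (λ e → inT e ≡ false)

  -- V_{G'} = V_G ∪ { w_e | e non-tree }
  V' : Set
  V' = V ⊎ NonTree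

  -- E_{G'}: inj₁ e is the edge named e (tree edge e itself, or (u,w_e) for
  -- non-tree e = (u,v)); inj₂ e is the edge e' = (w_e, v).
  E' : Set
  E' = E ⊎ NonTree

  ends₁ : (e : E) → (b : Bool) → inT e ≡ b → V' × V'
  ends₁ e true  _  = inj₁ (proj₁ (ends e)) , inj₁ (proj₂ (ends e))
  ends₁ e false eq = inj₁ (proj₁ (ends e)) , inj₂ (e , eq)

  ends' : E' → V' × V'
  ends' (inj₁ e) = ends₁ e (inT e) Relation.Binary.PropositionalEquality.refl
  ends' (inj₂ (e , eq)) = inj₂ (e , eq) , inj₁ (proj₂ (ends e))

  -- T' = T ∪ { (u, w_e) | e non-tree }
  inT' : E' → Bool
  inT' (inj₁ _) = true
  inT' (inj₂ _) = false

  root' : V → V'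
  root' r = inj₁ r

  σ : E → E'
  σ e = inj₁ e

  Lv : (V' → Label) → V → Label
  Lv TLv v = TLv (inj₁ v)

  Le : (E' → Label) → E → Label
  Le TLe e = TLe (σ e)

module Submission where

-- A path in G - F becomes a path in G' - σ(F) by routing every non-tree edge e = (u , v) through
-- w_e (neither e nor e' lies in σ(F) when e ∉ F). Conversely, contracting every w_e onto v maps a
-- path in G' - σ(F) to one in G - F: e' collapses to a point and e becomes the original edge.
-- So s and t are connected in G - F iff they are connected in G' - σ(F); as σ(F) is a set of at
-- most f tree edges of T', the tree scheme for G' answers the query (s , t , σ(F)), and its
-- labels are exactly those that L_{G,f} hands to the decoder.

open import Defs
open import Data.Nat using (ℕ; _≤_)
open import Data.Bool using (Bool; true; false)
open import Data.Fin using (Fin)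
open import Data.Product using (_×_; _,_; proj₂)
open import Data.Sum using (_⊎_; inj₁; inj₂)
open import Data.Sum.Properties using (inj₁-injective)
open import Data.List using (List; map)
open import Data.List.Properties using (length-map; map-∘)
open import Data.List.Membership.Propositional using (_∉_)
open import Data.List.Membership.Propositional.Properties using (∈-map⁺; ∈-map⁻)
open import Data.List.Relation.Unary.All using (universal)
import Data.List.Relation.Unary.All.Properties as All
import Data.List.Relation.Unary.Unique.Propositional.Properties as Unique
open import Relation.Binary.PropositionalEquality using (_≡_; refl; sym; subst)
open import Relation.Binary.Construct.Closure.ReflexiveTransitive using (ε; _◅_; kleisliStar)
open import Function using (_∋_)
open import Function.Bundles using (_⇔_; mk⇔; Equivalence)

module _ {V E : Set} (ends : E → V × V) (inT : E → Bool) where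
  open Subdivide ends inT

  contract : V' → V
  contract (inj₁ v)       = v
  contract (inj₂ (e , _)) = proj₂ (ends e)

  private
    ends'-inj₁ : ∀ e b (eq : inT e ≡ b) → ends' (inj₁ e) ≡ ends₁ e b eq
    ends'-inj₁ e b refl = refl

  module _ (F : List E) where

    inj₁∉⁺ : ∀ {e} → e ∉ F → (E' ∋ inj₁ e) ∉ map σ F
    inj₁∉⁺ e∉F e∈ with ∈-map⁻ σ e∈
    ... | _ , x∈F , refl = e∉F x∈F

    inj₁∉⁻ : ∀ {e} → inj₁ e ∉ map σ F → e ∉ F
    inj₁∉⁻ e∉ e∈F = e∉ (∈-map⁺ σ e∈F)

    inj₂∉ : ∀ {x : NonTree} → inj₂ x ∉ map σ F
    inj₂∉ x∈ with ∈-map⁻ σ x∈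
    ... | _ , _ , ()

    contract-edge : ∀ e b (eq : inT e ≡ b) {a c} → inj₁ e ∉ map σ F →
      ends₁ e b eq ≡ (a , c) ⊎ ends₁ e b eq ≡ (c , a) →
      ConnMinus ends F (contract a) (contract c)
    contract-edge e true  _ e∉ (inj₁ refl) = (e , inj₁∉⁻ e∉ , inj₁ refl) ◅ ε
    contract-edge e true  _ e∉ (inj₂ refl) = (e , inj₁∉⁻ e∉ , inj₂ refl) ◅ ε
    contract-edge e false _ e∉ (inj₁ refl) = (e , inj₁∉⁻ e∉ , inj₁ refl) ◅ ε
    contract-edge e false _ e∉ (inj₂ refl) = (e , inj₁∉⁻ e∉ , inj₂ refl) ◅ ε

    contract-step : ∀ {a c} → Step ends' (_∉ map σ F) a c →
      ConnMinus ends F (contract a) (contract c)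
    contract-step (inj₂ _ , _ , inj₁ refl) = ε
    contract-step (inj₂ _ , _ , inj₂ refl) = ε
    contract-step {a} {c} (inj₁ e , e∉ , a~c) =
      contract-edge e (inT e) refl e∉
        (subst (λ p → p ≡ (a , c) ⊎ p ≡ (c , a)) (ends'-inj₁ e (inT e) refl) a~c)

    subdivide-edge : ∀ e b (eq : inT e ≡ b) {s t} → e ∉ F →
      ends e ≡ (s , t) ⊎ ends e ≡ (t , s) →
      ConnMinus ends' (map σ F) (inj₁ s) (inj₁ t)
    subdivide-edge e true eq e∉F (inj₁ refl) =
      (inj₁ e , inj₁∉⁺ e∉F , inj₁ (ends'-inj₁ e true eq)) ◅ ε
    subdivide-edge e true eq e∉F (inj₂ refl) =
      (inj₁ e , inj₁∉⁺ e∉F , inj₂ (ends'-inj₁ e true eq)) ◅ ε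
    subdivide-edge e false eq e∉F (inj₁ refl) =
      (inj₁ e , inj₁∉⁺ e∉F , inj₁ (ends'-inj₁ e false eq)) ◅
      (inj₂ (e , eq) , inj₂∉ , inj₁ refl) ◅ ε
    subdivide-edge e false eq e∉F (inj₂ refl) =
      (inj₂ (e , eq) , inj₂∉ , inj₂ refl) ◅
      (inj₁ e , inj₁∉⁺ e∉F , inj₂ (ends'-inj₁ e false eq)) ◅ ε

    subdivide-step : ∀ {s t} → Step ends (_∉ F) s t →
      ConnMinus ends' (map σ F) (inj₁ s) (inj₁ t)
    subdivide-step (e , e∉F , s~t) = subdivide-edge e (inT e) refl e∉F s~t

    connMinus-subdivide : ∀ {s t} →
      ConnMinus ends F s t ⇔ ConnMinus ends' (map σ F) (inj₁ s) (inj₁ t)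
    connMinus-subdivide =
      mk⇔ (kleisliStar inj₁ subdivide-step) (kleisliStar contract contract-step)

  isFTCScheme-subdivide : ∀ f root TLv TLe TD →
    IsTreeFTCScheme f ends' inT' (root' root) TLv TLe TD →
    IsFTCScheme f ends (Lv TLv) (Le TLe) TD
  isFTCScheme-subdivide f _ TLv TLe TD tree-scheme s t F F-unique |F|≤f =
    mk⇔ (λ d → from (connMinus-subdivide F) (query.to (subst decodes (map-∘ F) d)))
        (λ c → subst decodes (sym (map-∘ F)) (query.from (to (connMinus-subdivide F) c)))
    where
      open Equivalence
      decodes : List Label → Set
      decodes labels = TD (TLv (inj₁ s)) (TLv (inj₁ t)) labels ≡ true
      module query = Equivalence
        (tree-scheme (inj₁ s) (inj₁ t) (map σ F) (Unique.map⁺ inj₁-injective F-unique)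
          (subst (_≤ f) (sym (length-map σ F)) |F|≤f)
          (All.map⁺ (universal (λ _ → refl) F)))

proposition1 : (n m : ℕ) (ends : Fin m → Fin n × Fin n) (inT : Fin m → Bool) (root : Fin n)
    → IsSpanningTree ends inT
    → (f : ℕ) → 1 ≤ f
    → (TLv : Subdivide.V' ends inT → Label) (TLe : Subdivide.E' ends inT → Label) (TD : Decoder)
    → IsTreeFTCScheme f (Subdivide.ends' ends inT) (Subdivide.inT' ends inT) (Subdivide.root' ends inT root) TLv TLe TD
    → IsFTCScheme f ends (Subdivide.Lv ends inT TLv) (Subdivide.Le ends inT TLe) TD
proposition1 n m ends inT root _ f _ =
  isFTCScheme-subdivide ends inT f root
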